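{- Let $\mathfrak F$ be a general $\mathsf{S4K}$-frame and $\varphi$ a formula of $\mathcal L_{\rightsquigarrow}$. Then $\mathfrak F\Vdash t(\varphi)$ iff $\hat\rho\mathfrak F\Vdash\varphi$.
   Context: $\mathcal L_{\rightsquigarrow}$: $\varphi::=p\mid\top\mid\bot\mid\varphi\wedge\varphi\mid\varphi\vee\varphi\mid\varphi\to\varphi\mid\varphi\rightsquigarrow\varphi$. $\mathcal L_{i,m}$: classical propositional formulas over the same variables with two unary boxes $\Box_i,\Box_m$. The translation $t:\mathcal L_{\rightsquigarrow}\to\mathcal L_{i,m}$: $t(p)=\Box_ip$, $t(\top)=\top$, $t(\bot)=\bot$, $t(\varphi\wedge\psi)=\Box_i(t\varphi\wedge t\psi)$, $t(\varphi\vee\psi)=\Box_i(t\varphi\vee t\psi)$, $t(\varphi\to\psi)=\Box_i(t\varphi\to t\psi)$, $t(\varphi\rightsquigarrow\psi)=\Box_i\Box_m(t\varphi\to t\psi)$. A general $\mathsf{S4K}$-frame $\mathfrak F=(X,R_i,R_m,Q)$: $R_i$ a preorder, $R_m$ a relation on $X$, $Q$ a Boolean subalgebra of the powerset closed under $[i]a=\{x:\forall y(xR_iy\Rightarrow y\in a)\}$ and $[m]a=\{x:\forall y(xR_my\Rightarrow y\in a)\}$. $\mathfrak F\Vdash\chi$ ($\chi\in\mathcal L_{i,m}$) means $\chi$ is true at every point under every valuation into $Q$, with the usual Kripke semantics for $\Box_i,\Box_m$ via $R_i,R_m$. A general $\rightsquigarrow$-frame $(Y,\preceq,\sqsubset,P)$: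 $\preceq$ partial order, $x\preceq y\sqsubset z\Rightarrow x\sqsubset z$, $P$ a family of upsets containing $Y,\emptyset$ closed under $\cap,\cup,\underline\to,\underline\rightsquigarrow$ where $a\underline{\to}b=\{x:\forall y(x\preceq y,y\in a\Rightarrow y\in b)\}$, $a\underline{\rightsquigarrow}b=\{x:\forall y(x\sqsubset y,y\in a\Rightarrow y\in b)\}$; it validates $\varphi$ if $\varphi$ is true everywhere under all valuations into $P$ (connectives interpreted by $\cap,\cup,\underline\to,\underline\rightsquigarrow$). $\hat\rho\mathfrak F$: $xR_m^*z$ iff $xR_iyR_mz$ for some $y$; $x\sim y$ iff $xR_iy$ and $yR_ix$; $[X]$ the set of classes $[x]$; $[x][R_i][y]$ iff $xR_iy$; $[x][R_m^*][y]$ iff $xR_m^*y'$ for some $y'\sim y$; $[Q]=\{\mathcal A\subseteq[X]:\bigcup\mathcal A\in Q\}$; $\hat\rho Q=\{[i]\mathcal A:\mathcal A\in[Q]\}$ with $[i]$ computed w.r.t. $[R_i]$; $\hat\rho\mathfrak F=([X],[R_i],[R_m^*],\hat\rho Q)$. -}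

module Defs where

open import Data.Nat using (ℕ)
open import Data.Product using (Σ; _×_; ∃)
open import Data.Sum using (_⊎_)
open import Data.Empty using (⊥)
open import Data.Unit using (⊤)
open import Relation.Nullary using (¬_)
open import Function.Bundles using (_⇔_)

Var : Set
Var = ℕ

data Fm : Set where
  var  : Var → Fm
  ⊤'   : Fm
  ⊥'   : Fm
  _∧'_ : Fm → Fm → Fm
  _∨'_ : Fm → Fm → Fm
  _⇒'_ : Fm → Fm → Fm
  _⇝'_ : Fm → Fm → Fm

data MFm : Set where
  mvar : Var → MFm
  m⊤   : MFm
  m⊥   : MFm
  _m∧_ : MFm → MFm → MFm
  _m∨_ : MFm → MFm → MFm
  _m⇒_ : MFm → MFm → MFm
  □i   : MFm → MFm
  □m   : MFm → MFm

t : Fm → MFm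
t (var p)   = □i (mvar p)
t ⊤'        = m⊤
t ⊥'        = m⊥
t (φ ∧' ψ)  = □i (t φ m∧ t ψ)
t (φ ∨' ψ)  = □i (t φ m∨ t ψ)
t (φ ⇒' ψ)  = □i (t φ m⇒ t ψ)
t (φ ⇝' ψ)  = □i (□m (t φ m⇒ t ψ))

Subset : Set → Set₁
Subset X = X → Set

_≐_ : {X : Set} → Subset X → Subset X → Set
a ≐ b = ∀ x → (a x ⇔ b x)

[_]⟨_⟩ : {X : Set} → (X → X → Set) → Subset X → Subset X
[ R ]⟨ a ⟩ = λ x → ∀ y → R x y → a y

record S4KFrame : Set₂ where
  field
    X      : Set
    Ri     : X → X → Set
    Rm     : X → X → Set
    Q      : Subset X → Set₁
    Ri-refl  : ∀ x → Ri x x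
    Ri-trans : ∀ {x y z} → Ri x y → Ri y z → Ri x z
    Q-ext    : ∀ {a b} → a ≐ b → Q a → Q b
    Q-top    : Q (λ _ → ⊤)
    Q-bot    : Q (λ _ → ⊥)
    Q-∩      : ∀ {a b} → Q a → Q b → Q (λ x → a x × b x)
    Q-∪      : ∀ {a b} → Q a → Q b → Q (λ x → a x ⊎ b x)
    Q-compl  : ∀ {a} → Q a → Q (λ x → ¬ a x)
    Q-[i]    : ∀ {a} → Q a → Q ([ Ri ]⟨ a ⟩)
    Q-[m]    : ∀ {a} → Q a → Q ([ Rm ]⟨ a ⟩)

module _ (F : S4KFrame) where
  open S4KFrame F

  mtruth : (Var → Subset X) → MFm → Subset X
  mtruth V (mvar p)  x = V p x
  mtruth V m⊤        x = ⊤
  mtruth V m⊥        x = ⊥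
  mtruth V (χ m∧ θ)  x = mtruth V χ x × mtruth V θ x
  mtruth V (χ m∨ θ)  x = mtruth V χ x ⊎ mtruth V θ x
  mtruth V (χ m⇒ θ)  x = mtruth V χ x → mtruth V θ x
  mtruth V (□i χ)    x = ∀ y → Ri x y → mtruth V χ y
  mtruth V (□m χ)    x = ∀ y → Rm x y → mtruth V χ y

  _⊩ₘ_ : MFm → Set₁
  _⊩ₘ_ χ = (V : Var → Subset X) → (∀ p → Q (V p)) → ∀ x → mtruth V χ x

-- A ⇝-structure (Y, ⪯, ⊏, P); the carrier Y is taken as a setoid
-- (equality _≈_) so that quotients such as [X] can be represented by
-- representatives.  Admissible sets are predicates in P.
record ⇝Structure : Set₂ where
  field
    Y   : Set
    _≈_ : Y → Y → Set
    _⪯_ : Y → Y → Set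
    _⊏_ : Y → Y → Set
    P   : Subset Y → Set₁

module _ (G : ⇝Structure) where
  open ⇝Structure G

  truth : (Var → Subset Y) → Fm → Subset Y
  truth V (var p)   y = V p y
  truth V ⊤'        y = ⊤
  truth V ⊥'        y = ⊥
  truth V (φ ∧' ψ)  y = truth V φ y × truth V ψ y
  truth V (φ ∨' ψ)  y = truth V φ y ⊎ truth V ψ y
  truth V (φ ⇒' ψ)  y = ∀ z → y ⪯ z → truth V φ z → truth V ψ z
  truth V (φ ⇝' ψ)  y = ∀ z → y ⊏ z → truth V φ z → truth V ψ z

  _⊩_ : Fm → Set₁
  _⊩_ φ = (V : Var → Subset Y) → (∀ p → P (V p)) → ∀ y → truth V φ y

-- The construction ρ̂F.  The class [x] is represented by x; subsets of [X]
-- are represented by ~-saturated predicates on X.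
module _ (F : S4KFrame) where
  open S4KFrame F

  _∼_ : X → X → Set
  x ∼ y = Ri x y × Ri y x

  Rm* : X → X → Set
  Rm* x z = ∃ λ y → Ri x y × Rm y z

  [Rm*] : X → X → Set
  [Rm*] x y = ∃ λ y' → Rm* x y' × (y' ∼ y)

  Saturated : Subset X → Set
  Saturated a = ∀ {x y} → x ∼ y → a x → a y

  -- [Q]: subsets A of [X] with ⋃A ∈ Q
  [Q] : Subset X → Set₁
  [Q] A = Saturated A × Q A

  ρ̂Q : Subset X → Set₁
  ρ̂Q B = Σ (Subset X) λ A → [Q] A × (B ≐ [ Ri ]⟨ A ⟩)

  ρ̂ : ⇝Structure
  ρ̂ = record
    { Y   = X
    ; _≈_ = _∼_
    ; _⪯_ = Ri
    ; _⊏_ = [Rm*]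
    ; P   = ρ̂Q
    }

{-# OPTIONS --safe #-}
module Submission where

open import Defs
open import Function.Bundles using (_⇔_; mk⇔; Equivalence)
open import Function.Construct.Identity using (⇔-id)
open import Function.Construct.Symmetry using (⇔-sym)
open import Function.Construct.Composition using (_⇔-∘_)
open import Function.Related.TypeIsomorphisms using (→-cong-⇔)
open import Data.Product using (_,_; proj₁; proj₂)
open import Data.Product.Function.NonDependent.Propositional using (_×-cong_)
open import Data.Sum.Function.Propositional using (_⊎-cong_)
open import Data.Sum using (inj₁; inj₂)
open import Data.Unit using (tt)

-- Valuations W into Q and V into ρ̂Q are matched by V p ≐ [i] (W p): every V
-- arises this way by definition of ρ̂Q, and every W yields V = [i] ∘ W since
-- [i] a is saturated and [i] is idempotent.  For matched valuations t φ and φ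
-- have the same truth set, by induction on φ: t φ is a □i-formula unless φ is
-- ⊤ or ⊥, and [i] fixes the R_i-upsets that truth sets of ρ̂F are; at ⇝ one
-- uses that [i][m] of a ~-saturated set is the box of [R_m^*].

[_]-cong : ∀ {X} (R : X → X → Set) {a b} → a ≐ b → [ R ]⟨ a ⟩ ≐ [ R ]⟨ b ⟩
[ R ]-cong a≐b x = mk⇔ (λ h y xy → Equivalence.to (a≐b y) (h y xy))
                       (λ h y xy → Equivalence.from (a≐b y) (h y xy))

module _ (F : S4KFrame) where
  open S4KFrame F
  open Equivalence

  UpSet : Subset X → Set
  UpSet a = ∀ {x y} → Ri x y → a x → a y

  UpSet⇒Saturated : ∀ {a} → UpSet a → Saturated F a
  UpSet⇒Saturated up (xy , _) = up xy

  [i]-upSet : ∀ a → UpSet [ Ri ]⟨ a ⟩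
  [i]-upSet a xy h z yz = h z (Ri-trans xy yz)

  [i]-upSet-≐ : ∀ {a} → UpSet a → [ Ri ]⟨ a ⟩ ≐ a
  [i]-upSet-≐ up x = mk⇔ (λ h → h x (Ri-refl x)) (λ h y xy → up xy h)

  [i]-idem : ∀ a → [ Ri ]⟨ [ Ri ]⟨ a ⟩ ⟩ ≐ [ Ri ]⟨ a ⟩
  [i]-idem a = [i]-upSet-≐ ([i]-upSet a)

  UpSet-resp-≐ : ∀ {a b} → a ≐ b → UpSet b → UpSet a
  UpSet-resp-≐ a≐b up {x} {y} xy h = from (a≐b y) (up xy (to (a≐b x) h))

  [i]∈ρ̂Q : ∀ {a} → Q a → ρ̂Q F [ Ri ]⟨ a ⟩
  [i]∈ρ̂Q {a} Qa =
    [ Ri ]⟨ a ⟩ , (UpSet⇒Saturated ([i]-upSet a) , Q-[i] Qa) , λ x → ⇔-sym ([i]-idem a x)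

  [i][m]-≐-[Rm*] : ∀ {c} → Saturated F c → [ Ri ]⟨ [ Rm ]⟨ c ⟩ ⟩ ≐ [ [Rm*] F ]⟨ c ⟩
  [i][m]-≐-[Rm*] sat x = mk⇔
    (λ h z (z' , (y , xy , yz') , z'∼z) → sat z'∼z (h y xy z' yz'))
    (λ h y xy z yz → h z (z , (y , xy , yz) , (Ri-refl z , Ri-refl z)))

  module _ {V : Var → Subset X} (V-upSet : ∀ p → UpSet (V p)) where

    truth-upSet : ∀ φ → UpSet (truth (ρ̂ F) V φ)
    truth-upSet (var p)  = V-upSet p
    truth-upSet ⊤'       _ _ = tt
    truth-upSet ⊥'       _ ()
    truth-upSet (φ ∧' ψ) xy (a , b) = truth-upSet φ xy a , truth-upSet ψ xy b
    truth-upSet (φ ∨' ψ) xy (inj₁ a) = inj₁ (truth-upSet φ xy a)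
    truth-upSet (φ ∨' ψ) xy (inj₂ b) = inj₂ (truth-upSet ψ xy b)
    truth-upSet (φ ⇒' ψ) = [i]-upSet _
    truth-upSet (φ ⇝' ψ) xy h z (z' , (w , yw , wz') , z'∼z) =
      h z (z' , (w , Ri-trans xy yw , wz') , z'∼z)

    truth-saturated : ∀ φ → Saturated F (truth (ρ̂ F) V φ)
    truth-saturated φ = UpSet⇒Saturated (truth-upSet φ)

    ⇒-saturated : ∀ φ ψ → Saturated F (λ x → truth (ρ̂ F) V φ x → truth (ρ̂ F) V ψ x)
    ⇒-saturated φ ψ (xy , yx) h a = truth-saturated ψ (xy , yx) (h (truth-saturated φ (yx , xy) a))

  module _ (W V : Var → Subset X) (V≐[i]W : ∀ p → V p ≐ [ Ri ]⟨ W p ⟩) where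

    V-upSet : ∀ p → UpSet (V p)
    V-upSet p = UpSet-resp-≐ (V≐[i]W p) ([i]-upSet (W p))

    t-≐-truth : ∀ φ → mtruth F W (t φ) ≐ truth (ρ̂ F) V φ
    t-≐-truth (var p)  x = ⇔-sym (V≐[i]W p x)
    t-≐-truth ⊤'       x = ⇔-id _
    t-≐-truth ⊥'       x = ⇔-id _
    t-≐-truth (φ ∧' ψ) x =
      [i]-upSet-≐ (truth-upSet V-upSet (φ ∧' ψ)) x
        ⇔-∘ [ Ri ]-cong (λ y → t-≐-truth φ y ×-cong t-≐-truth ψ y) x
    t-≐-truth (φ ∨' ψ) x =
      [i]-upSet-≐ (truth-upSet V-upSet (φ ∨' ψ)) x
        ⇔-∘ [ Ri ]-cong (λ y → t-≐-truth φ y ⊎-cong t-≐-truth ψ y) x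
    t-≐-truth (φ ⇒' ψ) =
      [ Ri ]-cong (λ y → →-cong-⇔ (t-≐-truth φ y) (t-≐-truth ψ y))
    t-≐-truth (φ ⇝' ψ) x =
      [i][m]-≐-[Rm*] (⇒-saturated V-upSet φ ψ) x
        ⇔-∘ [ Ri ]-cong ([ Rm ]-cong λ z → →-cong-⇔ (t-≐-truth φ z) (t-≐-truth ψ z)) x

lemma4p13 : (F : S4KFrame) (φ : Fm) → (_⊩ₘ_ F (t φ)) ⇔ (_⊩_ (ρ̂ F) φ)
lemma4p13 F φ = mk⇔ t-valid⇒valid valid⇒t-valid
  where
  open S4KFrame F
  open Equivalence

  t-valid⇒valid : _⊩ₘ_ F (t φ) → _⊩_ (ρ̂ F) φ
  t-valid⇒valid ⊩tφ V V∈ρ̂Q x =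
    to (t-≐-truth F W V (λ p → proj₂ (proj₂ (V∈ρ̂Q p))) φ x) (⊩tφ W W∈Q x)
    where
    W : Var → Subset X
    W p = proj₁ (V∈ρ̂Q p)
    W∈Q : ∀ p → Q (W p)
    W∈Q p = proj₂ (proj₁ (proj₂ (V∈ρ̂Q p)))

  valid⇒t-valid : _⊩_ (ρ̂ F) φ → _⊩ₘ_ F (t φ)
  valid⇒t-valid ⊩φ W W∈Q x =
    from (t-≐-truth F W (λ p → [ Ri ]⟨ W p ⟩) (λ p x → ⇔-id _) φ x)
         (⊩φ _ (λ p → [i]∈ρ̂Q F (W∈Q p)) x)
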